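{- Let $\mathcal A$ be an associative unital $\mathbb C$-algebra, $A,B\in\mathcal A$, and $\epsilon,\lambda\in\mathbb C$ nonzero. Then the following are equivalent: (i) $[B,A]=\epsilon(A+B)+\lambda(A+B)^2$; (ii) for all $n\in\mathbb N$, \[ [\lambda]_n(A+B)^n=\sum_{k=0}^n{n\brack k}\epsilon^{n-k}\sum_{j=0}^k\binom{k}{j}A^jB^{k-j}; \] (iii) for all $t$, $e^{At}e^{Bt}=\Big(1+\lambda(A+B)\frac{1-e^{ -\epsilon t}}{\epsilon}\Big)^{1/\lambda}$.
   Context: $[X,Y]=XY-YX$; $e^X=\sum_{n\ge0}X^n/n!$. ${n\brack k}$ denotes the unsigned Stirling numbers of the first kind, defined by $x(x-1)\cdots(x-n+1)=\sum_{k=0}^n{n\brack k}(-1)^{n-k}x^k$. $[x]_n:=\prod_{i=1}^{n-1}(1-ix)$ (empty product $=1$). For $X$ a formal series in $t$ with coefficients in $\mathcal A$ and scalar $\mu$, $X^\mu:=\sum_{k\ge0}(X-1)^k\binom{\mu}{k}$ with $\binom{\mu}{k}=\mu(\mu-1)\cdots(\mu-k+1)/k!$. Series are treated formally; identities in $t$ are equalities of formal power series in $t$. -}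

module Defs where

open import Level using (Level; _⊔_) renaming (suc to lsuc)
open import Algebra.Bundles using (Ring; CommutativeRing)
open import Data.Nat as ℕ using (ℕ; zero; suc; _∸_)
open import Data.Nat.Combinatorics using (_C_)
open import Data.Integer as ℤ using (ℤ; +_; -[1+_])
open import Data.Product using (_×_)
open import Function.Bundles using (_⇔_)
open import Relation.Nullary using (¬_)

-- The stirling numbers, defined exactly as in the paper:
-- x(x-1)...(x-n+1) = Σ_k S(n,k) (-1)^(n-k) x^k.
-- fallingCoeff n k is the coefficient of x^k in x(x-1)...(x-n+1),
-- obtained by literally expanding the product factor by factor
-- (multiplying p(x) by (x - n) gives coefficients p_{k-1} - n p_k).

fallingCoeff : ℕ → ℕ → ℤ
fallingCoeff zero zero = + 1
fallingCoeff zero (suc k) = + 0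
fallingCoeff (suc n) zero = ℤ.- ((+ n) ℤ.* fallingCoeff n zero)
fallingCoeff (suc n) (suc k) = fallingCoeff n k ℤ.- ((+ n) ℤ.* fallingCoeff n (suc k))

signPow : ℕ → ℤ
signPow zero = + 1
signPow (suc m) = ℤ.- signPow m

stirling1 : ℕ → ℕ → ℤ
stirling1 n k = signPow (n ∸ k) ℤ.* fallingCoeff n k

-- Scalar fields: a field of characteristic zero (stand-in for ℂ).

module RingUtil {c ℓ} (R : Ring c ℓ) where
  open Ring R
  ofℕ : ℕ → Carrier
  ofℕ zero = 0#
  ofℕ (suc n) = 1# + ofℕ n

  ofℤ : ℤ → Carrier
  ofℤ (+ n) = ofℕ n
  ofℤ -[1+ n ] = - ofℕ (suc n)

  pow : Carrier → ℕ → Carrier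
  pow x zero = 1#
  pow x (suc n) = x * pow x n

  sumTo : ℕ → (ℕ → Carrier) → Carrier
  sumTo zero f = f 0
  sumTo (suc n) f = sumTo n f + f (suc n)

  prodBelow : ℕ → (ℕ → Carrier) → Carrier
  prodBelow zero f = 1#
  prodBelow (suc n) f = prodBelow n f * f n

record CharZeroField (c ℓ : Level) : Set (lsuc (c ⊔ ℓ)) where
  field
    commutativeRing : CommutativeRing c ℓ
  open CommutativeRing commutativeRing public
  open RingUtil ring public
  field
    inv : (x : Carrier) → ¬ (x ≈ 0#) → Carrier
    inv-inverse : ∀ x (x≉0 : ¬ (x ≈ 0#)) → inv x x≉0 * x ≈ 1#
    charZero : ∀ n → ¬ (ofℕ (suc n) ≈ 0#)

record AlgebraOver {c ℓ} (K : CharZeroField c ℓ) (a ℓa : Level)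
       : Set (c ⊔ ℓ ⊔ lsuc (a ⊔ ℓa)) where
  module K = CharZeroField K
  field
    ring : Ring a ℓa
  open Ring ring public
  open RingUtil ring public
  infixr 7 _·_
  field
    _·_ : K.Carrier → Carrier → Carrier
    ·-cong : ∀ {k k' x y} → k K.≈ k' → x ≈ y → k · x ≈ k' · y
    ·-distribˡ : ∀ k x y → k · (x + y) ≈ k · x + k · y
    ·-distribʳ : ∀ k k' x → (k K.+ k') · x ≈ k · x + k' · x
    ·-assoc : ∀ k k' x → (k K.* k') · x ≈ k · (k' · x)
    ·-identity : ∀ x → K.1# · x ≈ x
    ·-*-assocˡ : ∀ k x y → k · (x * y) ≈ (k · x) * y
    ·-*-assocʳ : ∀ k x y → k · (x * y) ≈ x * (k · y)

module Conditions {c ℓ a ℓa} {K : CharZeroField c ℓ} (𝒜 : AlgebraOver K a ℓa) where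
  open AlgebraOver 𝒜
  open K using () renaming
    ( Carrier to Sc ; _+_ to _+ₖ_ ; _*_ to _*ₖ_ ; -_ to -ₖ_ ; 0# to 0ₖ ; 1# to 1ₖ
    ; _≈_ to _≈ₖ_ ; ofℕ to ofℕₖ ; ofℤ to ofℤₖ ; pow to powₖ ; prodBelow to prodₖ )

  factorial-inv : ℕ → Sc
  factorial-inv n = prodₖ n (λ i → K.inv (ofℕₖ (suc i)) (K.charZero i))

  ⟦_,_⟧ : Carrier → Carrier → Carrier
  ⟦ X , Y ⟧ = X * Y - Y * X

  risingBracket : Sc → ℕ → Sc
  risingBracket x n = prodₖ (n ∸ 1) (λ i → 1ₖ +ₖ (-ₖ (ofℕₖ (suc i) *ₖ x)))

  binomGen : Sc → ℕ → Sc
  binomGen μ k = factorial-inv k *ₖ prodₖ k (λ i → μ +ₖ (-ₖ ofℕₖ i))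

  -- Formal power series in t with coefficients in 𝒜 (coefficient functions),
  -- and with coefficients in K.
  Series : Set a
  Series = ℕ → Carrier

  SSeries : Set c
  SSeries = ℕ → Sc

  _⋆_ : Series → Series → Series
  (f ⋆ g) n = sumTo n (λ i → f i * g (n ∸ i))

  oneS : Series
  oneS zero = 1#
  oneS (suc n) = 0#

  powS : Series → ℕ → Series
  powS f zero = oneS
  powS f (suc k) = f ⋆ powS f k

  expS : Carrier → Series
  expS X n = factorial-inv n · pow X n

  expK : Sc → SSeries
  expK x n = factorial-inv n *ₖ powₖ x n

  oneMinusExpOver : (ε : Sc) → ¬ (ε ≈ₖ 0ₖ) → SSeries
  oneMinusExpOver ε ε≉0 n = K.inv ε ε≉0 *ₖ (δ n +ₖ (-ₖ expK (-ₖ ε) n))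
    where
    δ : ℕ → Sc
    δ zero = 1ₖ
    δ (suc _) = 0ₖ

  -- X^μ := Σ_k (X-1)^k binom(μ,k), for X a series with constant term 1.
  -- The t^n coefficient only receives contributions from k ≤ n
  -- (since X - 1 has zero constant term), so the formal sum is finite.
  seriesPow : (Y : Series) → Sc → Series   -- Y = X - 1
  seriesPow Y μ n = sumTo n (λ k → binomGen μ k · powS Y k n)

  CondI : (A B : Carrier) (ε lam : Sc) → Set ℓa
  CondI A B ε lam = ⟦ B , A ⟧ ≈ ε · (A + B) + lam · pow (A + B) 2

  CondII : (A B : Carrier) (ε lam : Sc) → Set ℓa
  CondII A B ε lam = ∀ (n : ℕ) →
    risingBracket lam n · pow (A + B) n
      ≈ sumTo n (λ k → (ofℤₖ (stirling1 n k) *ₖ powₖ ε (n ∸ k))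
                       · sumTo k (λ j → ofℕₖ (k C j) · (pow A j * pow B (k ∸ j))))

  CondIII : (A B : Carrier) (ε lam : Sc) → ¬ (ε ≈ₖ 0ₖ) → ¬ (lam ≈ₖ 0ₖ) → Set ℓa
  CondIII A B ε lam ε≉0 lam≉0 = ∀ (n : ℕ) →
    (expS A ⋆ expS B) n ≈ seriesPow Y (K.inv lam lam≉0) n
    where
    Y : Series
    Y m = (lam *ₖ oneMinusExpOver ε ε≉0 m) · (A + B)

-- Put S = A + B and N n = Σ_j C(n,j) A^j B^(n-j), so that e^{At} e^{Bt} = Σ_n N n tⁿ/n!
-- and N (n+1) = A N n + N n B.  Relation (i) gives S^m A = A S^m + m(ε S^m + λ S^(m+1)) for all m,
-- i.e. A S^m + S^m B = (1 - mλ) S^(m+1) - mε S^m, so the map X ↦ AX + XB sends [λ]_m S^m to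
-- [λ]_(m+1) S^(m+1) - mε [λ]_m S^m.  Consequently the expansions of [λ]_n S^n in the N k, and of
-- N n in the [λ]_k S^k, have coefficients obeying the recurrences of ε-scaled Stirling numbers of
-- the first and second kind.  The first expansion is (ii); the second is (iii) after comparing
-- coefficients, because with g = (1 - e^{-εt})/ε the series g^k/k! has the same Stirling
-- coefficients (g' = 1 - εg).  Conversely the n = 2 case of (ii) or (iii) says
-- N 2 + εS = (1 - λ) S², and N 2 - S² = AB - BA, which is (i).

module Submission where

open import Defs
open import Level using (Level)
open import Algebra.Bundles using (Ring; CommutativeRing)
open import Data.Maybe using (nothing)
open import Data.Nat as ℕ using (ℕ; zero; suc; _∸_; _≤_; _<_; z≤n; s≤s; _!)
import Data.Nat.Properties as ℕP
open import Data.Nat.Combinatorics using (_C_; nCk+nC[k+1]≡[n+1]C[k+1]; k>n⇒nCk≡0; nCk≡n!/k![n-k]!; k![n∸k]!∣n!)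
open import Data.Nat.DivMod using (m/n*n≡m)
open import Data.Integer as ℤ using (+_)
import Data.Integer.Properties as ℤP
open import Data.Integer.Tactic.RingSolver using (solve-∀)
open import Data.Product using (_×_; _,_)
open import Function.Bundles using (_⇔_; mk⇔; module Equivalence)
open import Relation.Binary.PropositionalEquality as P using (_≡_)
open import Relation.Nullary using (¬_; yes; no)
open import Tactic.RingSolver.Core.AlmostCommutativeRing using (fromCommutativeRing)
import Tactic.RingSolver.NonReflective as RingSolver
import Algebra.Solver.CommutativeMonoid as CommutativeMonoidSolver
import Algebra.Properties.Ring as RingProperties
import Algebra.Properties.CommutativeSemigroup as CommutativeSemigroupProperties
import Algebra.Properties.Semiring.Mult as SemiringMultProperties
import Algebra.Properties.Semiring.Exp as SemiringExpProperties
import Relation.Binary.Reasoning.Setoid as SetoidReasoning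

module RingLemmas {c ℓ} (R : Ring c ℓ) where
  open Ring R
  open RingUtil R
  open RingProperties R public
  open CommutativeSemigroupProperties +-commutativeSemigroup public
    using () renaming (interchange to +-interchange; x∙yz≈y∙xz to x+[y+z]≈y+[x+z])
  open SemiringMultProperties semiring using (×-homo-+; ×1-homo-*) renaming (_×_ to _times_)
  open SemiringExpProperties semiring using (_^_; ^-homo-*)
  open SetoidReasoning setoid

  ≡⇒≈ : ∀ {x y} → x ≡ y → x ≈ y
  ≡⇒≈ P.refl = refl

  ofℕ≈×1 : ∀ n → ofℕ n ≈ n times 1#
  ofℕ≈×1 zero = refl
  ofℕ≈×1 (suc n) = +-congˡ (ofℕ≈×1 n)

  ofℕ-+ : ∀ m n → ofℕ (m ℕ.+ n) ≈ ofℕ m + ofℕ n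
  ofℕ-+ m n = begin
    ofℕ (m ℕ.+ n)              ≈⟨ ofℕ≈×1 (m ℕ.+ n) ⟩
    (m ℕ.+ n) times 1#         ≈⟨ ×-homo-+ 1# m n ⟩
    m times 1# + n times 1#    ≈⟨ +-cong (ofℕ≈×1 m) (ofℕ≈×1 n) ⟨
    ofℕ m + ofℕ n              ∎

  ofℕ-* : ∀ m n → ofℕ (m ℕ.* n) ≈ ofℕ m * ofℕ n
  ofℕ-* m n = begin
    ofℕ (m ℕ.* n)                  ≈⟨ ofℕ≈×1 (m ℕ.* n) ⟩
    (m ℕ.* n) times 1#             ≈⟨ ×1-homo-* m n ⟩
    (m times 1#) * (n times 1#)    ≈⟨ *-cong (ofℕ≈×1 m) (ofℕ≈×1 n) ⟨
    ofℕ m * ofℕ n                  ∎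

  pow≈^ : ∀ x n → pow x n ≈ x ^ n
  pow≈^ x zero = refl
  pow≈^ x (suc n) = *-congˡ (pow≈^ x n)

  pow-+ : ∀ x m n → pow x (m ℕ.+ n) ≈ pow x m * pow x n
  pow-+ x m n = begin
    pow x (m ℕ.+ n)        ≈⟨ pow≈^ x (m ℕ.+ n) ⟩
    x ^ (m ℕ.+ n)          ≈⟨ ^-homo-* x m n ⟩
    x ^ m * x ^ n          ≈⟨ *-cong (pow≈^ x m) (pow≈^ x n) ⟨
    pow x m * pow x n      ∎

  pow-sucʳ : ∀ x n → pow x (suc n) ≈ pow x n * x
  pow-sucʳ x zero = trans (*-identityʳ x) (sym (*-identityˡ x))
  pow-sucʳ x (suc n) = trans (*-congˡ (pow-sucʳ x n)) (sym (*-assoc _ _ _))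

  sumTo-cong : ∀ n {f g : ℕ → Carrier} → (∀ i → i ≤ n → f i ≈ g i) → sumTo n f ≈ sumTo n g
  sumTo-cong zero f≈g = f≈g 0 z≤n
  sumTo-cong (suc n) f≈g = +-cong (sumTo-cong n (λ i i≤n → f≈g i (ℕP.m≤n⇒m≤1+n i≤n))) (f≈g (suc n) ℕP.≤-refl)

  sumTo-+ : ∀ n (f g : ℕ → Carrier) → sumTo n (λ i → f i + g i) ≈ sumTo n f + sumTo n g
  sumTo-+ zero f g = refl
  sumTo-+ (suc n) f g = trans (+-congʳ (sumTo-+ n f g)) (+-interchange _ _ _ _)

  -‿sumTo : ∀ n (f : ℕ → Carrier) → - sumTo n f ≈ sumTo n (λ i → - f i)
  -‿sumTo zero f = refl
  -‿sumTo (suc n) f = trans (sym (-‿+-comm _ _)) (+-congʳ (-‿sumTo n f))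

  sumTo-- : ∀ n (f g : ℕ → Carrier) → sumTo n (λ i → f i - g i) ≈ sumTo n f - sumTo n g
  sumTo-- n f g = trans (sumTo-+ n f (λ i → - g i)) (+-congˡ (sym (-‿sumTo n g)))

  *-distribˡ-sumTo : ∀ n x (f : ℕ → Carrier) → x * sumTo n f ≈ sumTo n (λ i → x * f i)
  *-distribˡ-sumTo zero x f = refl
  *-distribˡ-sumTo (suc n) x f = trans (distribˡ _ _ _) (+-congʳ (*-distribˡ-sumTo n x f))

  *-distribʳ-sumTo : ∀ n x (f : ℕ → Carrier) → sumTo n f * x ≈ sumTo n (λ i → f i * x)
  *-distribʳ-sumTo zero x f = refl
  *-distribʳ-sumTo (suc n) x f = trans (distribʳ _ _ _) (+-congʳ (*-distribʳ-sumTo n x f))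

  sumTo-zero : ∀ n {f : ℕ → Carrier} → (∀ i → f i ≈ 0#) → sumTo n f ≈ 0#
  sumTo-zero zero f≈0 = f≈0 0
  sumTo-zero (suc n) f≈0 = trans (+-cong (sumTo-zero n f≈0) (f≈0 (suc n))) (+-identityˡ 0#)

  sumTo-suc : ∀ n (f : ℕ → Carrier) → sumTo (suc n) f ≈ f 0 + sumTo n (λ i → f (suc i))
  sumTo-suc zero f = refl
  sumTo-suc (suc n) f = trans (+-congʳ (sumTo-suc n f)) (+-assoc _ _ _)

  sumTo-pascal : ∀ n {f g h : ℕ → Carrier} → f 0 ≈ h 0 →
                 (∀ k → k ≤ n → f (suc k) ≈ g k + h (suc k)) → h (suc n) ≈ 0# →
                 sumTo (suc n) f ≈ sumTo n g + sumTo n h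
  sumTo-pascal n {f} {g} {h} f0 fsuc hlast = begin
    sumTo (suc n) f                                 ≈⟨ sumTo-suc n f ⟩
    f 0 + sumTo n (λ k → f (suc k))                 ≈⟨ +-cong f0 (sumTo-cong n fsuc) ⟩
    h 0 + sumTo n (λ k → g k + h (suc k))           ≈⟨ +-congˡ (sumTo-+ n g (λ k → h (suc k))) ⟩
    h 0 + (sumTo n g + sumTo n (λ k → h (suc k)))   ≈⟨ x+[y+z]≈y+[x+z] _ _ _ ⟩
    sumTo n g + (h 0 + sumTo n (λ k → h (suc k)))   ≈⟨ +-congˡ (sumTo-suc n h) ⟨
    sumTo n g + (sumTo n h + h (suc n))             ≈⟨ +-congˡ (trans (+-congˡ hlast) (+-identityʳ _)) ⟩
    sumTo n g + sumTo n h                           ∎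

unsignedStirling₁ : ℕ → ℕ → ℕ
unsignedStirling₁ zero zero = 1
unsignedStirling₁ zero (suc k) = 0
unsignedStirling₁ (suc n) zero = n ℕ.* unsignedStirling₁ n zero
unsignedStirling₁ (suc n) (suc k) = unsignedStirling₁ n k ℕ.+ n ℕ.* unsignedStirling₁ n (suc k)

unsignedStirling₁-vanishes : ∀ {n k} → n < k → unsignedStirling₁ n k ≡ 0
unsignedStirling₁-vanishes {zero} {suc k} _ = P.refl
unsignedStirling₁-vanishes {suc n} {suc k} (s≤s n<k)
  rewrite unsignedStirling₁-vanishes n<k | unsignedStirling₁-vanishes (ℕP.m<n⇒m<1+n n<k) = ℕP.*-zeroʳ n

signPow-∸-suc : ∀ {k n} → k < n → signPow (n ∸ k) ≡ ℤ.- signPow (n ∸ suc k)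
signPow-∸-suc k<n = P.cong signPow (ℕP.+-∸-assoc 1 k<n)

signPow-square : ∀ m → signPow m ℤ.* signPow m ≡ + 1
signPow-square zero = P.refl
signPow-square (suc m) = P.trans (neg-square (signPow m)) (signPow-square m)
  where
  neg-square : ∀ x → (ℤ.- x) ℤ.* (ℤ.- x) ≡ x ℤ.* x
  neg-square = solve-∀

fallingCoeff≡signed : ∀ n k → fallingCoeff n k ≡ signPow (n ∸ k) ℤ.* + unsignedStirling₁ n k
fallingCoeff≡signed zero zero = P.refl
fallingCoeff≡signed zero (suc k) = P.refl
fallingCoeff≡signed (suc n) zero = begin
  ℤ.- (+ n ℤ.* fallingCoeff n 0)             ≡⟨ P.cong (λ x → ℤ.- (+ n ℤ.* x)) (fallingCoeff≡signed n 0) ⟩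
  ℤ.- (+ n ℤ.* (σ ℤ.* + u))                  ≡⟨ reassoc (+ n) σ (+ u) ⟩
  (ℤ.- σ) ℤ.* (+ n ℤ.* + u)                  ≡⟨ P.cong ((ℤ.- σ) ℤ.*_) (ℤP.pos-* n u) ⟨
  (ℤ.- σ) ℤ.* + (n ℕ.* u)                    ∎
  where
  open P.≡-Reasoning
  σ = signPow n
  u = unsignedStirling₁ n 0
  reassoc : ∀ a s b → ℤ.- (a ℤ.* (s ℤ.* b)) ≡ (ℤ.- s) ℤ.* (a ℤ.* b)
  reassoc = solve-∀
fallingCoeff≡signed (suc n) (suc k) with k ℕP.<? n
... | yes k<n = begin
  fallingCoeff n k ℤ.- + n ℤ.* fallingCoeff n (suc k)
    ≡⟨ P.cong₂ (λ x y → x ℤ.- + n ℤ.* y) (fallingCoeff≡signed n k) (fallingCoeff≡signed n (suc k)) ⟩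
  signPow (n ∸ k) ℤ.* + a ℤ.- + n ℤ.* (σ ℤ.* + b)
    ≡⟨ P.cong (λ s → s ℤ.* + a ℤ.- + n ℤ.* (σ ℤ.* + b)) (signPow-∸-suc k<n) ⟩
  (ℤ.- σ) ℤ.* + a ℤ.- + n ℤ.* (σ ℤ.* + b)    ≡⟨ factor σ (+ a) (+ n) (+ b) ⟩
  (ℤ.- σ) ℤ.* (+ a ℤ.+ + n ℤ.* + b)          ≡⟨ P.cong (λ s → s ℤ.* (+ a ℤ.+ + n ℤ.* + b)) (signPow-∸-suc k<n) ⟨
  signPow (n ∸ k) ℤ.* (+ a ℤ.+ + n ℤ.* + b)
    ≡⟨ P.cong (signPow (n ∸ k) ℤ.*_) (P.trans (P.cong (λ y → + a ℤ.+ y) (P.sym (ℤP.pos-* n b))) (P.sym (ℤP.pos-+ a (n ℕ.* b)))) ⟩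
  signPow (n ∸ k) ℤ.* + (a ℕ.+ n ℕ.* b)      ∎
  where
  open P.≡-Reasoning
  σ = signPow (n ∸ suc k)
  a = unsignedStirling₁ n k
  b = unsignedStirling₁ n (suc k)
  factor : ∀ s x m y → (ℤ.- s) ℤ.* x ℤ.- m ℤ.* (s ℤ.* y) ≡ (ℤ.- s) ℤ.* (x ℤ.+ m ℤ.* y)
  factor = solve-∀
... | no k≮n = begin
  fallingCoeff n k ℤ.- + n ℤ.* fallingCoeff n (suc k)
    ≡⟨ P.cong₂ (λ x y → x ℤ.- + n ℤ.* y) (fallingCoeff≡signed n k) (fallingCoeff≡signed n (suc k)) ⟩
  signPow (n ∸ k) ℤ.* + a ℤ.- + n ℤ.* (signPow (n ∸ suc k) ℤ.* + b)
    ≡⟨ P.cong (λ y → signPow (n ∸ k) ℤ.* + a ℤ.- + n ℤ.* (signPow (n ∸ suc k) ℤ.* + y)) b≡0 ⟩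
  signPow (n ∸ k) ℤ.* + a ℤ.- + n ℤ.* (signPow (n ∸ suc k) ℤ.* + 0)
    ≡⟨ drop (signPow (n ∸ k)) (+ a) (+ n) (signPow (n ∸ suc k)) ⟩
  signPow (n ∸ k) ℤ.* + a                    ≡⟨ P.cong (λ y → signPow (n ∸ k) ℤ.* + y) a+nb≡a ⟨
  signPow (n ∸ k) ℤ.* + (a ℕ.+ n ℕ.* b)      ∎
  where
  open P.≡-Reasoning
  a = unsignedStirling₁ n k
  b = unsignedStirling₁ n (suc k)
  b≡0 : b ≡ 0
  b≡0 = unsignedStirling₁-vanishes (s≤s (ℕP.≮⇒≥ k≮n))
  a+nb≡a : a ℕ.+ n ℕ.* b ≡ a
  a+nb≡a rewrite b≡0 | ℕP.*-zeroʳ n = ℕP.+-identityʳ a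
  drop : ∀ s x m t → s ℤ.* x ℤ.- m ℤ.* (t ℤ.* + 0) ≡ s ℤ.* x
  drop = solve-∀

stirling1≡unsigned : ∀ n k → stirling1 n k ≡ + unsignedStirling₁ n k
stirling1≡unsigned n k = begin
  σ ℤ.* fallingCoeff n k        ≡⟨ P.cong (σ ℤ.*_) (fallingCoeff≡signed n k) ⟩
  σ ℤ.* (σ ℤ.* + u)             ≡⟨ ℤP.*-assoc σ σ (+ u) ⟨
  (σ ℤ.* σ) ℤ.* + u             ≡⟨ P.cong (ℤ._* + u) (signPow-square (n ∸ k)) ⟩
  + 1 ℤ.* + u                   ≡⟨ ℤP.*-identityˡ (+ u) ⟩
  + u                           ∎
  where
  open P.≡-Reasoning
  σ = signPow (n ∸ k)
  u = unsignedStirling₁ n k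

module ScaledStirling {c ℓ} (R : CommutativeRing c ℓ) (ε : CommutativeRing.Carrier R) where
  open CommutativeRing R
  open RingUtil ring
  open RingLemmas ring
  open RingSolver (fromCommutativeRing R (λ _ → nothing)) using (solve; _⊕_; _⊗_; _⊜_)
  open SetoidReasoning setoid

  stirling₁ε : ℕ → ℕ → Carrier
  stirling₁ε n k = ofℤ (stirling1 n k) * pow ε (n ∸ k)

  stirling₁ε≈unsigned : ∀ n k → stirling₁ε n k ≈ ofℕ (unsignedStirling₁ n k) * pow ε (n ∸ k)
  stirling₁ε≈unsigned n k = *-congʳ (≡⇒≈ (P.cong ofℤ (stirling1≡unsigned n k)))

  stirling₁ε-vanishes : ∀ {n k} → n < k → stirling₁ε n k ≈ 0#
  stirling₁ε-vanishes {n} {k} n<k = begin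
    stirling₁ε n k                                          ≈⟨ stirling₁ε≈unsigned n k ⟩
    ofℕ (unsignedStirling₁ n k) * pow ε (n ∸ k)            ≡⟨ P.cong (λ u → ofℕ u * pow ε (n ∸ k)) (unsignedStirling₁-vanishes n<k) ⟩
    0# * pow ε (n ∸ k)                                      ≈⟨ zeroˡ _ ⟩
    0#                                                      ∎

  stirling₁ε-suc-zero : ∀ n → stirling₁ε (suc n) 0 ≈ (ofℕ n * ε) * stirling₁ε n 0
  stirling₁ε-suc-zero n = begin
    stirling₁ε (suc n) 0                          ≈⟨ stirling₁ε≈unsigned (suc n) 0 ⟩
    ofℕ (n ℕ.* u) * (ε * pow ε n)                 ≈⟨ *-congʳ (ofℕ-* n u) ⟩
    (ofℕ n * ofℕ u) * (ε * pow ε n)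
      ≈⟨ solve 4 (λ m a e f → ((m ⊗ a) ⊗ (e ⊗ f)) ⊜ ((m ⊗ e) ⊗ (a ⊗ f))) refl (ofℕ n) (ofℕ u) ε (pow ε n) ⟩
    (ofℕ n * ε) * (ofℕ u * pow ε n)               ≈⟨ *-congˡ (stirling₁ε≈unsigned n 0) ⟨
    (ofℕ n * ε) * stirling₁ε n 0                  ∎
    where
    u = unsignedStirling₁ n 0

  stirling₁ε-suc-suc : ∀ n k → stirling₁ε (suc n) (suc k) ≈ stirling₁ε n k + (ofℕ n * ε) * stirling₁ε n (suc k)
  stirling₁ε-suc-suc n k with k ℕP.<? n
  ... | yes k<n = begin
    stirling₁ε (suc n) (suc k)                                  ≈⟨ stirling₁ε≈unsigned (suc n) (suc k) ⟩
    ofℕ (a ℕ.+ n ℕ.* b) * pow ε (n ∸ k)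
      ≈⟨ *-cong (trans (ofℕ-+ a (n ℕ.* b)) (+-congˡ (ofℕ-* n b))) (≡⇒≈ (P.cong (pow ε) (ℕP.+-∸-assoc 1 k<n))) ⟩
    (ofℕ a + ofℕ n * ofℕ b) * (ε * e)
      ≈⟨ solve 5 (λ a m b ε e → ((a ⊕ m ⊗ b) ⊗ (ε ⊗ e)) ⊜ (a ⊗ (ε ⊗ e) ⊕ (m ⊗ ε) ⊗ (b ⊗ e)))
               refl (ofℕ a) (ofℕ n) (ofℕ b) ε e ⟩
    ofℕ a * (ε * e) + (ofℕ n * ε) * (ofℕ b * e)                 ≈⟨ +-cong (*-congˡ (≡⇒≈ (P.cong (pow ε) (ℕP.+-∸-assoc 1 k<n)))) refl ⟨
    ofℕ a * pow ε (n ∸ k) + (ofℕ n * ε) * (ofℕ b * e)           ≈⟨ +-cong (stirling₁ε≈unsigned n k) (*-congˡ (stirling₁ε≈unsigned n (suc k))) ⟨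
    stirling₁ε n k + (ofℕ n * ε) * stirling₁ε n (suc k)          ∎
    where
    a = unsignedStirling₁ n k
    b = unsignedStirling₁ n (suc k)
    e = pow ε (n ∸ suc k)
  ... | no k≮n = begin
    stirling₁ε (suc n) (suc k)                                  ≈⟨ stirling₁ε≈unsigned (suc n) (suc k) ⟩
    ofℕ (a ℕ.+ n ℕ.* b) * pow ε (n ∸ k)                         ≡⟨ P.cong (λ u → ofℕ u * pow ε (n ∸ k)) a+nb≡a ⟩
    ofℕ a * pow ε (n ∸ k)                                       ≈⟨ stirling₁ε≈unsigned n k ⟨
    stirling₁ε n k                                              ≈⟨ +-identityʳ _ ⟨
    stirling₁ε n k + 0#                                         ≈⟨ +-congˡ (trans (*-congˡ (stirling₁ε-vanishes n<suc-k)) (zeroʳ _)) ⟨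
    stirling₁ε n k + (ofℕ n * ε) * stirling₁ε n (suc k)          ∎
    where
    a = unsignedStirling₁ n k
    b = unsignedStirling₁ n (suc k)
    n<suc-k : n < suc k
    n<suc-k = s≤s (ℕP.≮⇒≥ k≮n)
    a+nb≡a : a ℕ.+ n ℕ.* b ≡ a
    a+nb≡a rewrite unsignedStirling₁-vanishes n<suc-k | ℕP.*-zeroʳ n = ℕP.+-identityʳ a

  stirling₁ε-diagonal : ∀ n → stirling₁ε n n ≈ 1#
  stirling₁ε-diagonal n = begin
    stirling₁ε n n                                   ≈⟨ stirling₁ε≈unsigned n n ⟩
    ofℕ (unsignedStirling₁ n n) * pow ε (n ∸ n)      ≡⟨ P.cong₂ (λ u m → ofℕ u * pow ε m) (diagonal n) (ℕP.n∸n≡0 n) ⟩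
    ofℕ 1 * 1#                                       ≈⟨ trans (*-identityʳ _) (+-identityʳ 1#) ⟩
    1#                                               ∎
    where
    diagonal : ∀ n → unsignedStirling₁ n n ≡ 1
    diagonal zero = P.refl
    diagonal (suc n) rewrite diagonal n | unsignedStirling₁-vanishes (ℕP.n<1+n n) | ℕP.*-zeroʳ n = P.refl

  -- (-ε)^(n-k) S(n,k), with S the Stirling numbers of the second kind
  stirling₂ε : ℕ → ℕ → Carrier
  stirling₂ε zero zero = 1#
  stirling₂ε zero (suc k) = 0#
  stirling₂ε (suc n) zero = 0#
  stirling₂ε (suc n) (suc k) = stirling₂ε n k - (ofℕ (suc k) * ε) * stirling₂ε n (suc k)

  stirling₂ε-vanishes : ∀ {n k} → n < k → stirling₂ε n k ≈ 0#
  stirling₂ε-vanishes {zero} {suc k} _ = refl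
  stirling₂ε-vanishes {suc n} {suc k} (s≤s n<k) = begin
    stirling₂ε n k - (ofℕ (suc k) * ε) * stirling₂ε n (suc k)
      ≈⟨ +-cong (stirling₂ε-vanishes n<k) (-‿cong (*-congˡ (stirling₂ε-vanishes (ℕP.m<n⇒m<1+n n<k)))) ⟩
    0# - (ofℕ (suc k) * ε) * 0#                                 ≈⟨ +-congˡ (-‿cong (zeroʳ _)) ⟩
    0# - 0#                                                     ≈⟨ -‿inverseʳ 0# ⟩
    0#                                                          ∎

  stirling₂ε-diagonal : ∀ n → stirling₂ε n n ≈ 1#
  stirling₂ε-diagonal zero = refl
  stirling₂ε-diagonal (suc n) = begin
    stirling₂ε n n - (ofℕ (suc n) * ε) * stirling₂ε n (suc n)
      ≈⟨ +-cong (stirling₂ε-diagonal n) (-‿cong (*-congˡ (stirling₂ε-vanishes (ℕP.n<1+n n)))) ⟩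
    1# - (ofℕ (suc n) * ε) * 0#                                 ≈⟨ +-congˡ (trans (-‿cong (zeroʳ _)) -0#≈0#) ⟩
    1# + 0#                                                     ≈⟨ +-identityʳ 1# ⟩
    1#                                                          ∎

module ScalarAction {c ℓ a ℓa} {K : CharZeroField c ℓ} (𝒜 : AlgebraOver K a ℓa) where
  open AlgebraOver 𝒜
  open K using () renaming (Carrier to Sc; _+_ to _+ₖ_; _*_ to _*ₖ_; -_ to -ₖ_; 0# to 0ₖ; _≈_ to _≈ₖ_; sumTo to sumₖ)
  open RingLemmas ring
  open SetoidReasoning setoid

  ·-congˡ : ∀ {k x y} → x ≈ y → k · x ≈ k · y
  ·-congˡ = ·-cong K.refl

  ·-congʳ : ∀ {k k′ x} → k ≈ₖ k′ → k · x ≈ k′ · x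
  ·-congʳ k≈k′ = ·-cong k≈k′ refl

  ·-zeroˡ : ∀ x → 0ₖ · x ≈ 0#
  ·-zeroˡ x = x+x≈x⇒x≈0 _ (trans (sym (·-distribʳ 0ₖ 0ₖ x)) (·-congʳ (K.+-identityˡ 0ₖ)))

  ·-negˡ : ∀ k x → (-ₖ k) · x ≈ - (k · x)
  ·-negˡ k x = +-inverseˡ-unique _ _ (begin
    (-ₖ k) · x + k · x   ≈⟨ ·-distribʳ _ _ _ ⟨
    ((-ₖ k) +ₖ k) · x    ≈⟨ ·-congʳ (K.-‿inverseˡ k) ⟩
    0ₖ · x               ≈⟨ ·-zeroˡ x ⟩
    0#                   ∎)

  ·-comm : ∀ k k′ x → k · (k′ · x) ≈ k′ · (k · x)
  ·-comm k k′ x = begin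
    k · (k′ · x)      ≈⟨ ·-assoc _ _ _ ⟨
    (k *ₖ k′) · x     ≈⟨ ·-congʳ (K.*-comm k k′) ⟩
    (k′ *ₖ k) · x     ≈⟨ ·-assoc _ _ _ ⟩
    k′ · (k · x)      ∎

  ·-*-· : ∀ k k′ x y → (k · x) * (k′ · y) ≈ (k *ₖ k′) · (x * y)
  ·-*-· k k′ x y = begin
    (k · x) * (k′ · y)    ≈⟨ ·-*-assocˡ _ _ _ ⟨
    k · (x * (k′ · y))    ≈⟨ ·-congˡ (·-*-assocʳ _ _ _) ⟨
    k · (k′ · (x * y))    ≈⟨ ·-assoc _ _ _ ⟨
    (k *ₖ k′) · (x * y)   ∎

  ·-sumTo : ∀ n k (f : ℕ → Carrier) → k · sumTo n f ≈ sumTo n (λ i → k · f i)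
  ·-sumTo zero k f = refl
  ·-sumTo (suc n) k f = trans (·-distribˡ _ _ _) (+-congʳ (·-sumTo n k f))

  sumTo-· : ∀ n (f : ℕ → Sc) x → sumₖ n f · x ≈ sumTo n (λ i → f i · x)
  sumTo-· zero f x = refl
  sumTo-· (suc n) f x = trans (·-distribʳ _ _ _) (+-congʳ (sumTo-· n f x))

  ofℕ1·x≈x : ∀ x → K.ofℕ 1 · x ≈ x
  ofℕ1·x≈x x = trans (·-congʳ (K.+-identityʳ K.1#)) (·-identity x)

module NormalOrdering {c ℓ a ℓa} {K : CharZeroField c ℓ} (𝒜 : AlgebraOver K a ℓa) (A B : AlgebraOver.Carrier 𝒜) where
  open AlgebraOver 𝒜
  open K using () renaming (Carrier to Sc; _+_ to _+ₖ_; _*_ to _*ₖ_; 0# to 0ₖ; _≈_ to _≈ₖ_; ofℕ to ofℕₖ)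
  open RingLemmas ring
  open ScalarAction 𝒜
  open SetoidReasoning setoid
  private module K′ = RingLemmas K.ring

  normalOrdered : ℕ → Carrier
  normalOrdered n = sumTo n (λ j → ofℕₖ (n C j) · (pow A j * pow B (n ∸ j)))

  leftA+rightB : Carrier → Carrier
  leftA+rightB X = A * X + X * B

  leftA+rightB-cong : ∀ {X Y} → X ≈ Y → leftA+rightB X ≈ leftA+rightB Y
  leftA+rightB-cong X≈Y = +-cong (*-congˡ X≈Y) (*-congʳ X≈Y)

  leftA+rightB-+ : ∀ X Y → leftA+rightB (X + Y) ≈ leftA+rightB X + leftA+rightB Y
  leftA+rightB-+ X Y = trans (+-cong (distribˡ _ _ _) (distribʳ _ _ _)) (+-interchange _ _ _ _)

  leftA+rightB-· : ∀ k X → leftA+rightB (k · X) ≈ k · leftA+rightB X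
  leftA+rightB-· k X = begin
    A * (k · X) + (k · X) * B    ≈⟨ +-cong (·-*-assocʳ _ _ _) (·-*-assocˡ _ _ _) ⟨
    k · (A * X) + k · (X * B)    ≈⟨ ·-distribˡ _ _ _ ⟨
    k · leftA+rightB X           ∎

  leftA+rightB-sumTo : ∀ n (f : ℕ → Sc) (X : ℕ → Carrier) →
    leftA+rightB (sumTo n (λ i → f i · X i)) ≈ sumTo n (λ i → f i · leftA+rightB (X i))
  leftA+rightB-sumTo zero f X = leftA+rightB-· _ _
  leftA+rightB-sumTo (suc n) f X = trans (leftA+rightB-+ _ _) (+-cong (leftA+rightB-sumTo n f X) (leftA+rightB-· _ _))

  normalOrdered-suc : ∀ n → normalOrdered (suc n) ≈ leftA+rightB (normalOrdered n)
  normalOrdered-suc n = begin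
    normalOrdered (suc n)
      ≈⟨ sumTo-pascal n {h = λ j → ofℕₖ (n C j) · (pow A j * pow B (suc n ∸ j))} refl pascal last-vanishes ⟩
    sumTo n (λ j → ofℕₖ (n C j) · (A * term j))
      + sumTo n (λ j → ofℕₖ (n C j) · (pow A j * pow B (suc n ∸ j)))
                                                     ≈⟨ +-cong (sumTo-cong n (λ j _ → ·-*-assocʳ _ _ _)) (sumTo-cong n right) ⟩
    sumTo n (λ j → A * (ofℕₖ (n C j) · term j))
      + sumTo n (λ j → (ofℕₖ (n C j) · term j) * B)  ≈⟨ +-cong (*-distribˡ-sumTo n A _) (*-distribʳ-sumTo n B _) ⟨
    leftA+rightB (normalOrdered n)                   ∎
    where
    term : ℕ → Carrier
    term j = pow A j * pow B (n ∸ j)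
    pascal : ∀ j → j ≤ n → ofℕₖ (suc n C suc j) · (pow A (suc j) * pow B (n ∸ j))
                           ≈ ofℕₖ (n C j) · (A * term j) + ofℕₖ (n C suc j) · (pow A (suc j) * pow B (n ∸ j))
    pascal j _ = begin
      ofℕₖ (suc n C suc j) · (A * pow A j * pow B (n ∸ j))
        ≈⟨ ·-congʳ (K′.≡⇒≈ (P.cong ofℕₖ (nCk+nC[k+1]≡[n+1]C[k+1] n j))) ⟨
      ofℕₖ (n C j ℕ.+ n C suc j) · (A * pow A j * pow B (n ∸ j))
        ≈⟨ trans (·-congʳ (K′.ofℕ-+ (n C j) (n C suc j))) (·-distribʳ _ _ _) ⟩
      ofℕₖ (n C j) · (A * pow A j * pow B (n ∸ j)) + ofℕₖ (n C suc j) · (A * pow A j * pow B (n ∸ j))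
        ≈⟨ +-congʳ (·-congˡ (*-assoc _ _ _)) ⟩
      ofℕₖ (n C j) · (A * term j) + ofℕₖ (n C suc j) · (A * pow A j * pow B (n ∸ j)) ∎
    last-vanishes : ofℕₖ (n C suc n) · (pow A (suc n) * pow B (n ∸ n)) ≈ 0#
    last-vanishes = trans (·-congʳ (K′.≡⇒≈ (P.cong ofℕₖ (k>n⇒nCk≡0 (ℕP.n<1+n n))))) (·-zeroˡ _)
    right : ∀ j → j ≤ n → ofℕₖ (n C j) · (pow A j * pow B (suc n ∸ j)) ≈ (ofℕₖ (n C j) · term j) * B
    right j j≤n = begin
      ofℕₖ (n C j) · (pow A j * pow B (suc n ∸ j))   ≡⟨ P.cong (λ m → ofℕₖ (n C j) · (pow A j * pow B m)) (ℕP.+-∸-assoc 1 j≤n) ⟩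
      ofℕₖ (n C j) · (pow A j * pow B (suc (n ∸ j))) ≈⟨ ·-congˡ (*-congˡ (pow-sucʳ B (n ∸ j))) ⟩
      ofℕₖ (n C j) · (pow A j * (pow B (n ∸ j) * B)) ≈⟨ ·-congˡ (*-assoc _ _ _) ⟨
      ofℕₖ (n C j) · (term j * B)                    ≈⟨ ·-*-assocˡ _ _ _ ⟩
      (ofℕₖ (n C j) · term j) * B                    ∎

  module Expansion (P : ℕ → Carrier) (β : ℕ → Sc) (leftA+rightB-P : ∀ k → leftA+rightB (P k) ≈ P (suc k) + β k · P k)
                   (α : ℕ → Sc) (a : ℕ → ℕ → Sc) (a-vanishes : ∀ {n k} → n < k → a n k ≈ₖ 0ₖ)
                   (a-suc-zero : ∀ n → a (suc n) 0 ≈ₖ (α n +ₖ β 0) *ₖ a n 0)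
                   (a-suc-suc : ∀ n k → a (suc n) (suc k) ≈ₖ a n k +ₖ (α n +ₖ β (suc k)) *ₖ a n (suc k)) where

    expansion : ℕ → Carrier
    expansion n = sumTo n (λ k → a n k · P k)

    expansion-suc : ∀ n → expansion (suc n) ≈ leftA+rightB (expansion n) + α n · expansion n
    expansion-suc n = begin
      expansion (suc n)
        ≈⟨ sumTo-pascal n {h = λ k → ((α n +ₖ β k) *ₖ a n k) · P k} (·-congʳ (a-suc-zero n)) shift last-vanishes ⟩
      sumTo n (λ k → a n k · P (suc k)) + sumTo n (λ k → ((α n +ₖ β k) *ₖ a n k) · P k)
        ≈⟨ +-congˡ (trans (sumTo-cong n (λ k _ → split k)) (sumTo-+ n _ _)) ⟩
      sumTo n (λ k → a n k · P (suc k)) + (sumTo n (λ k → a n k · (β k · P k)) + sumTo n (λ k → α n · (a n k · P k)))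
        ≈⟨ +-assoc _ _ _ ⟨
      (sumTo n (λ k → a n k · P (suc k)) + sumTo n (λ k → a n k · (β k · P k))) + sumTo n (λ k → α n · (a n k · P k))
        ≈⟨ +-cong (sumTo-+ n _ _) (·-sumTo n (α n) _) ⟨
      sumTo n (λ k → a n k · P (suc k) + a n k · (β k · P k)) + α n · expansion n
        ≈⟨ +-congʳ (sumTo-cong n (λ k _ → trans (·-congˡ (leftA+rightB-P k)) (·-distribˡ _ _ _))) ⟨
      sumTo n (λ k → a n k · leftA+rightB (P k)) + α n · expansion n
        ≈⟨ +-congʳ (leftA+rightB-sumTo n (a n) P) ⟨
      leftA+rightB (expansion n) + α n · expansion n ∎
      where
      shift : ∀ k → k ≤ n → a (suc n) (suc k) · P (suc k) ≈ a n k · P (suc k) + ((α n +ₖ β (suc k)) *ₖ a n (suc k)) · P (suc k)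
      shift k _ = trans (·-congʳ (a-suc-suc n k)) (·-distribʳ _ _ _)
      last-vanishes : ((α n +ₖ β (suc n)) *ₖ a n (suc n)) · P (suc n) ≈ 0#
      last-vanishes = trans (·-congʳ (K.trans (K.*-congˡ (a-vanishes (ℕP.n<1+n n))) (K.zeroʳ _))) (·-zeroˡ _)
      split : ∀ k → ((α n +ₖ β k) *ₖ a n k) · P k ≈ a n k · (β k · P k) + α n · (a n k · P k)
      split k = begin
        ((α n +ₖ β k) *ₖ a n k) · P k                    ≈⟨ trans (·-congʳ (K.distribʳ _ _ _)) (·-distribʳ _ _ _) ⟩
        (α n *ₖ a n k) · P k + (β k *ₖ a n k) · P k      ≈⟨ +-comm _ _ ⟩
        (β k *ₖ a n k) · P k + (α n *ₖ a n k) · P k      ≈⟨ +-cong (trans (·-assoc _ _ _) (·-comm _ _ _)) (·-assoc _ _ _) ⟩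
        a n k · (β k · P k) + α n · (a n k · P k)        ∎

module StirlingExpansions {c ℓ a ℓa} {K : CharZeroField c ℓ} (𝒜 : AlgebraOver K a ℓa)
                  (A B : AlgebraOver.Carrier 𝒜) (ε lam : CharZeroField.Carrier K) where
  open AlgebraOver 𝒜
  open K using () renaming (Carrier to Sc; _+_ to _+ₖ_; _*_ to _*ₖ_; -_ to -ₖ_; _-_ to _-ₖ_; 0# to 0ₖ; 1# to 1ₖ;
                            _≈_ to _≈ₖ_; ofℕ to ofℕₖ)
  open RingLemmas ring
  open ScalarAction 𝒜
  open NormalOrdering 𝒜 A B
  open ScaledStirling K.commutativeRing ε
  open Conditions 𝒜 using (CondI; CondII; risingBracket)
  open SetoidReasoning setoid
  private module K′ = RingLemmas K.ring

  S : Carrier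
  S = A + B

  γ : ℕ → Sc
  γ n = ofℕₖ n *ₖ ε

  private
    leftA+rightB-normalOrdered : ∀ k → leftA+rightB (normalOrdered k) ≈ normalOrdered (suc k) + 0ₖ · normalOrdered k
    leftA+rightB-normalOrdered k = trans (sym (normalOrdered-suc k)) (sym (trans (+-congˡ (·-zeroˡ _)) (+-identityʳ _)))

  open Expansion normalOrdered (λ _ → 0ₖ) leftA+rightB-normalOrdered γ stirling₁ε stirling₁ε-vanishes
                 (λ n → K.trans (stirling₁ε-suc-zero n) (K.*-congʳ (K.sym (K.+-identityʳ _))))
                 (λ n k → K.trans (stirling₁ε-suc-suc n k) (K.+-congˡ (K.*-congʳ (K.sym (K.+-identityʳ _)))))
    renaming (expansion to stirling₁Sum; expansion-suc to stirling₁Sum-suc)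

  bracketPow : ℕ → Carrier
  bracketPow k = risingBracket lam k · pow S k

  risingBracket-suc : ∀ n → risingBracket lam (suc n) ≈ₖ risingBracket lam n *ₖ (1ₖ -ₖ ofℕₖ n *ₖ lam)
  risingBracket-suc zero = K.sym (K.trans (K.*-identityˡ _) (K.trans (K.+-congˡ (K.trans (K.-‿cong (K.zeroˡ lam)) K′.-0#≈0#)) (K.+-identityʳ _)))
  risingBracket-suc (suc n) = K.refl

  stirling₂Sum : ℕ → Carrier
  stirling₂Sum n = sumTo n (λ k → stirling₂ε n k · bracketPow k)

  module UnderCommutation (hyp : CondI A B ε lam) where

    φ : ℕ → Carrier
    φ m = ε · pow S m + lam · pow S (suc m)

    S*A : S * A ≈ A * S + φ 1
    S*A = begin
      (A + B) * A              ≈⟨ distribʳ _ _ _ ⟩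
      A * A + B * A            ≈⟨ +-congˡ (trans (sym (//-rightDividesˡ (A * B) (B * A))) (+-cong (trans hyp φ₁) refl)) ⟩
      A * A + (φ 1 + A * B)    ≈⟨ trans (+-congˡ (+-comm _ _)) (sym (+-assoc _ _ _)) ⟩
      (A * A + A * B) + φ 1    ≈⟨ +-congʳ (distribˡ _ _ _) ⟨
      A * S + φ 1              ∎
      where
      φ₁ : ε · S + lam · pow S 2 ≈ φ 1
      φ₁ = +-congʳ (·-congˡ (sym (*-identityʳ S)))

    pow-S*A : ∀ m → pow S m * A ≈ A * pow S m + ofℕₖ m · φ m
    pow-S*A zero = begin
      1# * A                   ≈⟨ trans (*-identityˡ A) (sym (*-identityʳ A)) ⟩
      A * 1#                   ≈⟨ +-identityʳ _ ⟨
      A * 1# + 0#              ≈⟨ +-congˡ (·-zeroˡ _) ⟨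
      A * 1# + 0ₖ · φ 0        ∎
    pow-S*A (suc m) = begin
      S * pow S m * A                            ≈⟨ *-assoc _ _ _ ⟩
      S * (pow S m * A)                          ≈⟨ *-congˡ (pow-S*A m) ⟩
      S * (A * pow S m + ofℕₖ m · φ m)           ≈⟨ distribˡ _ _ _ ⟩
      S * (A * pow S m) + S * (ofℕₖ m · φ m)     ≈⟨ +-cong (sym (*-assoc _ _ _)) (sym (·-*-assocʳ _ _ _)) ⟩
      (S * A) * pow S m + ofℕₖ m · (S * φ m)     ≈⟨ +-cong (*-congʳ S*A) (·-congˡ S*φ) ⟩
      (A * S + φ 1) * pow S m + ofℕₖ m · φ (suc m)
                                                 ≈⟨ +-congʳ (trans (distribʳ _ _ _) (+-cong (*-assoc _ _ _) φ₁*pow)) ⟩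
      (A * pow S (suc m) + φ (suc m)) + ofℕₖ m · φ (suc m)
                                                 ≈⟨ +-assoc _ _ _ ⟩
      A * pow S (suc m) + (φ (suc m) + ofℕₖ m · φ (suc m))
                                                 ≈⟨ +-congˡ (trans (+-congʳ (sym (·-identity _))) (sym (·-distribʳ _ _ _))) ⟩
      A * pow S (suc m) + ofℕₖ (suc m) · φ (suc m) ∎
      where
      S*φ : S * φ m ≈ φ (suc m)
      S*φ = trans (distribˡ _ _ _) (+-cong (sym (·-*-assocʳ _ _ _)) (sym (·-*-assocʳ _ _ _)))
      φ₁*pow : φ 1 * pow S m ≈ φ (suc m)
      φ₁*pow = trans (distribʳ _ _ _) (+-cong (trans (sym (·-*-assocˡ _ _ _)) (·-congˡ (sym (pow-+ S 1 m))))
                                               (trans (sym (·-*-assocˡ _ _ _)) (·-congˡ (sym (pow-+ S 2 m)))))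

    pow-S-suc : ∀ m → pow S (suc m) ≈ leftA+rightB (pow S m) + ofℕₖ m · φ m
    pow-S-suc m = begin
      pow S (suc m)                                  ≈⟨ pow-sucʳ S m ⟩
      pow S m * (A + B)                              ≈⟨ distribˡ _ _ _ ⟩
      pow S m * A + pow S m * B                      ≈⟨ +-congʳ (pow-S*A m) ⟩
      (A * pow S m + ofℕₖ m · φ m) + pow S m * B     ≈⟨ +-assoc _ _ _ ⟩
      A * pow S m + (ofℕₖ m · φ m + pow S m * B)     ≈⟨ +-congˡ (+-comm _ _) ⟩
      A * pow S m + (pow S m * B + ofℕₖ m · φ m)     ≈⟨ +-assoc _ _ _ ⟨
      leftA+rightB (pow S m) + ofℕₖ m · φ m          ∎

    leftA+rightB-pow-S : ∀ m → leftA+rightB (pow S m) + γ m · pow S m ≈ (1ₖ -ₖ ofℕₖ m *ₖ lam) · pow S (suc m)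
    leftA+rightB-pow-S m = begin
      T + γ m · pow S m                            ≈⟨ //-rightDividesʳ L _ ⟨
      ((T + γ m · pow S m) + L) - L                ≈⟨ +-congʳ (trans (+-assoc _ _ _) (+-congˡ mφ)) ⟩
      (T + ofℕₖ m · φ m) - L                       ≈⟨ +-congʳ (pow-S-suc m) ⟨
      pow S (suc m) - L                            ≈⟨ +-cong (·-identity _) (·-negˡ _ _) ⟨
      1ₖ · pow S (suc m) + (-ₖ (ofℕₖ m *ₖ lam)) · pow S (suc m)
                                                   ≈⟨ ·-distribʳ _ _ _ ⟨
      (1ₖ -ₖ ofℕₖ m *ₖ lam) · pow S (suc m)         ∎
      where
      T = leftA+rightB (pow S m)
      L = (ofℕₖ m *ₖ lam) · pow S (suc m)
      mφ : γ m · pow S m + L ≈ ofℕₖ m · φ m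
      mφ = trans (+-cong (·-assoc _ _ _) (·-assoc _ _ _)) (sym (·-distribˡ _ _ _))

    bracketPow-suc : ∀ n → bracketPow (suc n) ≈ leftA+rightB (bracketPow n) + γ n · bracketPow n
    bracketPow-suc n = begin
      risingBracket lam (suc n) · pow S (suc n)                         ≈⟨ trans (·-congʳ (risingBracket-suc n)) (·-assoc _ _ _) ⟩
      risingBracket lam n · ((1ₖ -ₖ ofℕₖ n *ₖ lam) · pow S (suc n))     ≈⟨ ·-congˡ (leftA+rightB-pow-S n) ⟨
      risingBracket lam n · (leftA+rightB (pow S n) + γ n · pow S n)    ≈⟨ ·-distribˡ _ _ _ ⟩
      risingBracket lam n · leftA+rightB (pow S n) + risingBracket lam n · (γ n · pow S n)
                                                                        ≈⟨ +-cong (leftA+rightB-· _ _) (·-comm _ _ _) ⟨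
      leftA+rightB (bracketPow n) + γ n · bracketPow n                  ∎

    condII : CondII A B ε lam
    condII zero = begin
      1ₖ · 1#                           ≈⟨ ·-identity 1# ⟩
      1#                                ≈⟨ trans (ofℕ1·x≈x _) (*-identityˡ 1#) ⟨
      K.ofℕ 1 · (1# * 1#)               ≈⟨ ofℕ1·x≈x _ ⟨
      K.ofℕ 1 · (K.ofℕ 1 · (1# * 1#))   ≈⟨ ·-congʳ (K.*-identityʳ _) ⟨
      stirling₁Sum 0                    ∎
    condII (suc n) = begin
      bracketPow (suc n)                                     ≈⟨ bracketPow-suc n ⟩
      leftA+rightB (bracketPow n) + γ n · bracketPow n       ≈⟨ +-cong (leftA+rightB-cong (condII n)) (·-congˡ (condII n)) ⟩
      leftA+rightB (stirling₁Sum n) + γ n · stirling₁Sum n   ≈⟨ stirling₁Sum-suc n ⟨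
      stirling₁Sum (suc n)                                   ∎

    leftA+rightB-bracketPow : ∀ k → leftA+rightB (bracketPow k) ≈ bracketPow (suc k) + (-ₖ γ k) · bracketPow k
    leftA+rightB-bracketPow k = trans (x≈z//y _ _ _ (sym (bracketPow-suc k))) (+-congˡ (sym (·-negˡ _ _)))

    open Expansion bracketPow (λ k → -ₖ γ k) leftA+rightB-bracketPow (λ _ → 0ₖ) stirling₂ε stirling₂ε-vanishes
                   (λ n → K.sym (K.trans (K.*-congʳ (K.trans (K.+-identityˡ _) (K.trans (K.-‿cong (K.zeroˡ ε)) K′.-0#≈0#))) (K.zeroˡ _)))
                   (λ n k → K.+-congˡ (K.trans (K′.-‿distribˡ-* _ _) (K.*-congʳ (K.sym (K.+-identityˡ _)))))
      using () renaming (expansion-suc to stirling₂Sum-suc)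

    normalOrdered≈stirling₂Sum : ∀ n → normalOrdered n ≈ stirling₂Sum n
    normalOrdered≈stirling₂Sum zero = begin
      K.ofℕ 1 · (1# * 1#)      ≈⟨ trans (ofℕ1·x≈x _) (*-identityˡ 1#) ⟩
      1#                       ≈⟨ trans (·-identity _) (·-identity _) ⟨
      1ₖ · (1ₖ · 1#)           ∎
    normalOrdered≈stirling₂Sum (suc n) = begin
      normalOrdered (suc n)                                  ≈⟨ normalOrdered-suc n ⟩
      leftA+rightB (normalOrdered n)                         ≈⟨ leftA+rightB-cong (normalOrdered≈stirling₂Sum n) ⟩
      leftA+rightB (stirling₂Sum n)                          ≈⟨ +-identityʳ _ ⟨
      leftA+rightB (stirling₂Sum n) + 0#                     ≈⟨ +-congˡ (·-zeroˡ _) ⟨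
      leftA+rightB (stirling₂Sum n) + 0ₖ · stirling₂Sum n    ≈⟨ stirling₂Sum-suc n ⟨
      stirling₂Sum (suc n)                                   ∎

  private module +-Solver = CommutativeMonoidSolver +-commutativeMonoid

  normalOrdered-one : normalOrdered 1 ≈ S
  normalOrdered-one = begin
    K.ofℕ 1 · (1# * (B * 1#)) + K.ofℕ 1 · ((A * 1#) * 1#)   ≈⟨ +-cong (ofℕ1·x≈x _) (ofℕ1·x≈x _) ⟩
    1# * (B * 1#) + (A * 1#) * 1#
      ≈⟨ +-cong (trans (*-identityˡ _) (*-identityʳ B)) (trans (*-identityʳ _) (*-identityʳ A)) ⟩
    B + A                                                   ≈⟨ +-comm B A ⟩
    S                                                       ∎

  normalOrdered-two+BA : normalOrdered 2 + B * A ≈ pow S 2 + A * B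
  normalOrdered-two+BA = begin
    normalOrdered 2 + B * A                                  ≈⟨ +-congʳ (+-cong (+-cong BB AB+AB) AA) ⟩
    ((B * B + (A * B + A * B)) + A * A) + B * A              ≈⟨ +-Solver.solve 4 (λ aa ab ba bb →
                                                                  (((bb ⊕ (ab ⊕ ab)) ⊕ aa) ⊕ ba) ⊜ (((aa ⊕ ab) ⊕ (ba ⊕ bb)) ⊕ ab))
                                                                  refl (A * A) (A * B) (B * A) (B * B) ⟩
    ((A * A + A * B) + (B * A + B * B)) + A * B              ≈⟨ +-congʳ (trans (distribʳ _ _ _) (+-cong (distribˡ _ _ _) (distribˡ _ _ _))) ⟨
    S * S + A * B                                            ≈⟨ +-congʳ (*-congˡ (*-identityʳ S)) ⟨
    pow S 2 + A * B                                          ∎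
    where
    open +-Solver using (_⊕_; _⊜_)
    BB : K.ofℕ 1 · (1# * (B * (B * 1#))) ≈ B * B
    BB = trans (ofℕ1·x≈x _) (trans (*-identityˡ _) (*-congˡ (*-identityʳ B)))
    AB+AB : K.ofℕ 2 · ((A * 1#) * (B * 1#)) ≈ A * B + A * B
    AB+AB = trans (·-congʳ (K.+-congˡ (K.+-identityʳ 1ₖ))) (trans (·-distribʳ _ _ _)
              (trans (+-cong (·-identity _) (·-identity _)) (+-cong AB AB)))
      where
      AB : (A * 1#) * (B * 1#) ≈ A * B
      AB = *-cong (*-identityʳ A) (*-identityʳ B)
    AA : K.ofℕ 1 · ((A * (A * 1#)) * 1#) ≈ A * A
    AA = trans (ofℕ1·x≈x _) (trans (*-identityʳ _) (*-congˡ (*-identityʳ A)))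

  condI-from-degreeTwo : normalOrdered 2 + ε · S ≈ (1ₖ -ₖ lam) · pow S 2 → CondI A B ε lam
  condI-from-degreeTwo h = sym (trans (y≈x\\z _ _ _ (+-cancelˡ Q _ _ step)) (+-comm _ _))
    where
    open +-Solver using (_⊕_; _⊜_)
    Q = pow S 2
    E = ε · S + lam · Q
    step : Q + (A * B + E) ≈ Q + B * A
    step = begin
      Q + (A * B + E)                            ≈⟨ +-assoc _ _ _ ⟨
      (Q + A * B) + E                            ≈⟨ +-congʳ normalOrdered-two+BA ⟨
      (normalOrdered 2 + B * A) + E              ≈⟨ +-Solver.solve 4 (λ p ba es lq → ((p ⊕ ba) ⊕ (es ⊕ lq)) ⊜ (((p ⊕ es) ⊕ lq) ⊕ ba))
                                                      refl (normalOrdered 2) (B * A) (ε · S) (lam · Q) ⟩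
      ((normalOrdered 2 + ε · S) + lam · Q) + B * A
                                                 ≈⟨ +-congʳ (+-congʳ (trans h (trans (·-distribʳ _ _ _) (+-cong (·-identity Q) (·-negˡ _ _))))) ⟩
      ((Q - lam · Q) + lam · Q) + B * A          ≈⟨ +-congʳ (//-rightDividesˡ (lam · Q) Q) ⟩
      Q + B * A                                  ∎

  risingBracket-two : risingBracket lam 2 ≈ₖ 1ₖ -ₖ lam
  risingBracket-two = K.trans (K.*-identityˡ _) (K.+-congˡ (K.-‿cong (K.trans (K.*-congʳ (K.+-identityʳ 1ₖ)) (K.*-identityˡ lam))))

  bracketPow-two : bracketPow 2 ≈ (1ₖ -ₖ lam) · pow S 2
  bracketPow-two = ·-congʳ risingBracket-two

  stirling₁Sum-two : stirling₁Sum 2 ≈ ε · S + normalOrdered 2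
  stirling₁Sum-two = +-cong (trans (+-cong (trans (·-congʳ (K.zeroˡ _)) (·-zeroˡ _)) (·-cong ε₂₁ normalOrdered-one)) (+-identityˡ _))
                            (trans (·-congʳ (stirling₁ε-diagonal 2)) (·-identity _))
    where
    ε₂₁ : stirling₁ε 2 1 ≈ₖ ε
    ε₂₁ = K.trans (K.*-cong (K.+-identityʳ 1ₖ) (K.*-identityʳ ε)) (K.*-identityˡ ε)

  stirling₂Sum-two : stirling₂Sum 2 ≈ (-ₖ ε) · S + (1ₖ -ₖ lam) · pow S 2
  stirling₂Sum-two = +-cong (trans (+-cong (·-zeroˡ _) (·-cong ε₂₁ (trans (·-identity _) (*-identityʳ S)))) (+-identityˡ _))
                            (trans (·-congʳ (stirling₂ε-diagonal 2)) (trans (·-identity _) bracketPow-two))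
    where
    ε₂₁ : stirling₂ε 2 1 ≈ₖ -ₖ ε
    ε₂₁ = K.trans (K.+-identityˡ _) (K.-‿cong (K.trans (K.*-congˡ (stirling₂ε-diagonal 1))
            (K.trans (K.*-identityʳ _) (K.trans (K.*-congʳ (K.+-identityʳ 1ₖ)) (K.*-identityˡ ε)))))

  condII⇒condI : CondII A B ε lam → CondI A B ε lam
  condII⇒condI h = condI-from-degreeTwo (begin
    normalOrdered 2 + ε · S         ≈⟨ +-comm _ _ ⟩
    ε · S + normalOrdered 2         ≈⟨ stirling₁Sum-two ⟨
    stirling₁Sum 2                  ≈⟨ h 2 ⟨
    bracketPow 2                    ≈⟨ bracketPow-two ⟩
    (1ₖ -ₖ lam) · pow S 2           ∎)

  stirling₂Expansion⇒condI : normalOrdered 2 ≈ stirling₂Sum 2 → CondI A B ε lam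
  stirling₂Expansion⇒condI h = condI-from-degreeTwo (begin
    normalOrdered 2 + ε · S                               ≈⟨ +-congʳ (trans h stirling₂Sum-two) ⟩
    ((-ₖ ε) · S + (1ₖ -ₖ lam) · pow S 2) + ε · S          ≈⟨ +-congʳ (trans (+-comm _ _) (+-congˡ (·-negˡ _ _))) ⟩
    ((1ₖ -ₖ lam) · pow S 2 - ε · S) + ε · S               ≈⟨ //-rightDividesˡ _ _ ⟩
    (1ₖ -ₖ lam) · pow S 2                                 ∎)

module ExponentialSeries {c ℓ} (K : CharZeroField c ℓ) (ε : CharZeroField.Carrier K)
                         (ε≉0 : ¬ (CharZeroField._≈_ K ε (CharZeroField.0# K))) where
  open CharZeroField K
  open RingLemmas ring
  open ScaledStirling commutativeRing ε
  open SetoidReasoning setoid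
  open CommutativeSemigroupProperties *-commutativeSemigroup using () renaming (x∙yz≈y∙xz to x*[y*z]≈y*[x*z])
  private module ×-Solver = CommutativeMonoidSolver *-commutativeMonoid

  Series : Set c
  Series = ℕ → Carrier

  infixl 7 _⋆_
  _⋆_ : Series → Series → Series
  (a ⋆ b) n = sumTo n (λ i → a i * b (n ∸ i))

  ∂ : Series → Series
  ∂ a n = ofℕ (suc n) * a (suc n)

  δ : Series
  δ zero = 1#
  δ (suc _) = 0#

  -- literally the body of Conditions.factorial-inv, so the two are interchangeable
  factorialInv : ℕ → Carrier
  factorialInv n = prodBelow n (λ i → inv (ofℕ (suc i)) (charZero i))

  e : Series
  e n = factorialInv n * pow (- ε) n

  g : Series
  g n = inv ε ε≉0 * (δ n - e n)

  gPow : ℕ → Series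
  gPow zero = δ
  gPow (suc k) = g ⋆ gPow k

  ofℕ[n!]*factorialInv : ∀ n → ofℕ (n !) * factorialInv n ≈ 1#
  ofℕ[n!]*factorialInv zero = trans (*-identityʳ _) (+-identityʳ 1#)
  ofℕ[n!]*factorialInv (suc n) = begin
    ofℕ (suc n ℕ.* n !) * (factorialInv n * ι)           ≈⟨ *-congʳ (ofℕ-* (suc n) (n !)) ⟩
    (ofℕ (suc n) * ofℕ (n !)) * (factorialInv n * ι)     ≈⟨ ×-Solver.solve 4 (λ m f i ι → ((m ⊕ f) ⊕ (i ⊕ ι)) ⊜ ((ι ⊕ m) ⊕ (f ⊕ i)))
                                                            refl (ofℕ (suc n)) (ofℕ (n !)) (factorialInv n) ι ⟩
    (ι * ofℕ (suc n)) * (ofℕ (n !) * factorialInv n)     ≈⟨ *-cong (inv-inverse _ _) (ofℕ[n!]*factorialInv n) ⟩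
    1# * 1#                                              ≈⟨ *-identityˡ 1# ⟩
    1#                                                   ∎
    where
    open ×-Solver using (_⊕_; _⊜_)
    ι = inv (ofℕ (suc n)) (charZero n)

  factorialInv-binomial : ∀ {n i} → i ≤ n → factorialInv i * factorialInv (n ∸ i) ≈ factorialInv n * ofℕ (n C i)
  factorialInv-binomial {n} {i} i≤n = begin
    fi * fj                                     ≈⟨ *-identityʳ _ ⟨
    (fi * fj) * 1#                              ≈⟨ *-congˡ (ofℕ[n!]*factorialInv n) ⟨
    (fi * fj) * (ofℕ (n !) * fn)                ≈⟨ *-congˡ (*-congʳ n!≈) ⟩
    (fi * fj) * ((ofℕ (n C i) * (ofℕ (i !) * ofℕ ((n ∸ i) !))) * fn)
                                                ≈⟨ ×-Solver.solve 6 (λ fi fj c a b fn → ((fi ⊕ fj) ⊕ ((c ⊕ (a ⊕ b)) ⊕ fn)) ⊜ ((fn ⊕ c) ⊕ ((a ⊕ fi) ⊕ (b ⊕ fj))))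
                                                     refl fi fj (ofℕ (n C i)) (ofℕ (i !)) (ofℕ ((n ∸ i) !)) fn ⟩
    (fn * ofℕ (n C i)) * ((ofℕ (i !) * fi) * (ofℕ ((n ∸ i) !) * fj))
                                                ≈⟨ *-congˡ (trans (*-cong (ofℕ[n!]*factorialInv i) (ofℕ[n!]*factorialInv (n ∸ i))) (*-identityˡ 1#)) ⟩
    (fn * ofℕ (n C i)) * 1#                     ≈⟨ *-identityʳ _ ⟩
    fn * ofℕ (n C i)                            ∎
    where
    open ×-Solver using (_⊕_; _⊜_)
    fi = factorialInv i
    fj = factorialInv (n ∸ i)
    fn = factorialInv n
    n!≈ : ofℕ (n !) ≈ ofℕ (n C i) * (ofℕ (i !) * ofℕ ((n ∸ i) !))
    n!≈ = begin
      ofℕ (n !)                                      ≡⟨ P.cong ofℕ (P.trans (P.cong (ℕ._* (i ! ℕ.* (n ∸ i) !)) (nCk≡n!/k![n-k]! i≤n))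
                                                                           (m/n*n≡m (k![n∸k]!∣n! i≤n))) ⟨
      ofℕ ((n C i) ℕ.* (i ! ℕ.* (n ∸ i) !))          ≈⟨ trans (ofℕ-* (n C i) _) (*-congˡ (ofℕ-* (i !) ((n ∸ i) !))) ⟩
      ofℕ (n C i) * (ofℕ (i !) * ofℕ ((n ∸ i) !))    ∎
      where instance _ = i ℕP.!* (n ∸ i) !≢0

  δ⋆ : ∀ b n → (δ ⋆ b) n ≈ b n
  δ⋆ b zero = *-identityˡ _
  δ⋆ b (suc n) = begin
    (δ ⋆ b) (suc n)                                   ≈⟨ sumTo-suc n _ ⟩
    1# * b (suc n) + sumTo n (λ i → 0# * b (n ∸ i))   ≈⟨ +-cong (*-identityˡ _) (sumTo-zero n (λ i → zeroˡ _)) ⟩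
    b (suc n) + 0#                                    ≈⟨ +-identityʳ _ ⟩
    b (suc n)                                         ∎

  ∂-⋆ : ∀ a b n → ∂ (a ⋆ b) n ≈ (∂ a ⋆ b) n + (a ⋆ ∂ b) n
  ∂-⋆ a b n = begin
    ofℕ (suc n) * sumTo (suc n) (λ i → a i * b (suc n ∸ i))      ≈⟨ *-distribˡ-sumTo (suc n) _ _ ⟩
    sumTo (suc n) (λ i → ofℕ (suc n) * (a i * b (suc n ∸ i)))
      ≈⟨ sumTo-pascal n {h = λ i → a i * (ofℕ (suc n ∸ i) * b (suc n ∸ i))} (x*[y*z]≈y*[x*z] _ _ _) split last-vanishes ⟩
    (∂ a ⋆ b) n + sumTo n (λ i → a i * (ofℕ (suc n ∸ i) * b (suc n ∸ i)))
      ≈⟨ +-congˡ (sumTo-cong n (λ i i≤n → ≡⇒≈ (P.cong (λ m → a i * (ofℕ m * b m)) (ℕP.+-∸-assoc 1 i≤n)))) ⟩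
    (∂ a ⋆ b) n + (a ⋆ ∂ b) n                                    ∎
    where
    split : ∀ i → i ≤ n → ofℕ (suc n) * (a (suc i) * b (n ∸ i))
                          ≈ ∂ a i * b (n ∸ i) + a (suc i) * (ofℕ (n ∸ i) * b (n ∸ i))
    split i i≤n = begin
      ofℕ (suc n) * (a (suc i) * b (n ∸ i))                        ≡⟨ P.cong (λ m → ofℕ m * (a (suc i) * b (n ∸ i))) (ℕP.m+[n∸m]≡n (s≤s i≤n)) ⟨
      ofℕ (suc i ℕ.+ (n ∸ i)) * (a (suc i) * b (n ∸ i))            ≈⟨ trans (*-congʳ (ofℕ-+ (suc i) (n ∸ i))) (distribʳ _ _ _) ⟩
      ofℕ (suc i) * (a (suc i) * b (n ∸ i)) + ofℕ (n ∸ i) * (a (suc i) * b (n ∸ i))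
                                                                   ≈⟨ +-cong (sym (*-assoc _ _ _)) (x*[y*z]≈y*[x*z] _ _ _) ⟩
      ∂ a i * b (n ∸ i) + a (suc i) * (ofℕ (n ∸ i) * b (n ∸ i))    ∎
    last-vanishes : a (suc n) * (ofℕ (n ∸ n) * b (n ∸ n)) ≈ 0#
    last-vanishes = begin
      a (suc n) * (ofℕ (n ∸ n) * b (n ∸ n))    ≡⟨ P.cong (λ m → a (suc n) * (ofℕ m * b m)) (ℕP.n∸n≡0 n) ⟩
      a (suc n) * (0# * b 0)                   ≈⟨ trans (*-congˡ (zeroˡ _)) (zeroʳ _) ⟩
      0#                                       ∎

  ⋆-linearˡ : ∀ n {a b c : Series} x d → (∀ i → a i ≈ b i - x * c i) → (a ⋆ d) n ≈ (b ⋆ d) n - x * (c ⋆ d) n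
  ⋆-linearˡ n {a} {b} {c} x d a≈ = begin
    (a ⋆ d) n                                                           ≈⟨ sumTo-cong n (λ i _ → term i) ⟩
    sumTo n (λ i → b i * d (n ∸ i) - x * (c i * d (n ∸ i)))             ≈⟨ sumTo-- n _ _ ⟩
    (b ⋆ d) n - sumTo n (λ i → x * (c i * d (n ∸ i)))                  ≈⟨ +-congˡ (-‿cong (*-distribˡ-sumTo n x _)) ⟨
    (b ⋆ d) n - x * (c ⋆ d) n                                           ∎
    where
    term : ∀ i → a i * d (n ∸ i) ≈ b i * d (n ∸ i) - x * (c i * d (n ∸ i))
    term i = trans (*-congʳ (a≈ i)) (trans (distribʳ _ _ _) (+-congˡ (trans (sym (-‿distribˡ-* _ _)) (-‿cong (*-assoc _ _ _)))))

  ⋆-linearʳ : ∀ n a {b c d : Series} m x → (∀ i → b i ≈ m * (c i - x * d i)) → (a ⋆ b) n ≈ m * ((a ⋆ c) n - x * (a ⋆ d) n)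
  ⋆-linearʳ n a {b} {c} {d} m x b≈ = begin
    (a ⋆ b) n                                                           ≈⟨ sumTo-cong n (λ i _ → term i) ⟩
    sumTo n (λ i → m * (a i * c (n ∸ i) - x * (a i * d (n ∸ i))))       ≈⟨ *-distribˡ-sumTo n m _ ⟨
    m * sumTo n (λ i → a i * c (n ∸ i) - x * (a i * d (n ∸ i)))         ≈⟨ *-congˡ (sumTo-- n _ _) ⟩
    m * ((a ⋆ c) n - sumTo n (λ i → x * (a i * d (n ∸ i))))            ≈⟨ *-congˡ (+-congˡ (-‿cong (*-distribˡ-sumTo n x _))) ⟨
    m * ((a ⋆ c) n - x * (a ⋆ d) n)                                     ∎
    where
    term : ∀ i → a i * b (n ∸ i) ≈ m * (a i * c (n ∸ i) - x * (a i * d (n ∸ i)))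
    term i = begin
      a i * b (n ∸ i)                                  ≈⟨ *-congˡ (b≈ (n ∸ i)) ⟩
      a i * (m * (c (n ∸ i) - x * d (n ∸ i)))          ≈⟨ x*[y*z]≈y*[x*z] _ _ _ ⟩
      m * (a i * (c (n ∸ i) - x * d (n ∸ i)))          ≈⟨ *-congˡ (x[y-z]≈xy-xz _ _ _) ⟩
      m * (a i * c (n ∸ i) - a i * (x * d (n ∸ i)))    ≈⟨ *-congˡ (+-congˡ (-‿cong (x*[y*z]≈y*[x*z] _ _ _))) ⟩
      m * (a i * c (n ∸ i) - x * (a i * d (n ∸ i)))    ∎

  g-zero : g 0 ≈ 0#
  g-zero = trans (*-congˡ (trans (+-congˡ (-‿cong (*-identityˡ 1#))) (-‿inverseʳ 1#))) (zeroʳ _)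

  ∂g : ∀ n → ∂ g n ≈ δ n - ε * g n
  ∂g n = begin
    ofℕ (suc n) * (ε⁻¹ * (0# - (factorialInv n * ι) * (- ε * p)))   ≈⟨ *-congˡ (*-congˡ (trans (+-identityˡ _) neg-neg)) ⟩
    ofℕ (suc n) * (ε⁻¹ * ((factorialInv n * ι) * (ε * p)))
      ≈⟨ ×-Solver.solve 6 (λ m v f i x q → (m ⊕ (v ⊕ ((f ⊕ i) ⊕ (x ⊕ q)))) ⊜ ((i ⊕ m) ⊕ ((v ⊕ x) ⊕ (f ⊕ q))))
           refl (ofℕ (suc n)) ε⁻¹ (factorialInv n) ι ε p ⟩
    (ι * ofℕ (suc n)) * ((ε⁻¹ * ε) * e n)                             ≈⟨ *-cong (inv-inverse _ _) (*-congʳ (inv-inverse ε ε≉0)) ⟩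
    1# * (1# * e n)                                                  ≈⟨ trans (*-identityˡ _) (*-identityˡ _) ⟩
    e n                                                              ≈⟨ y≈x\\z _ _ _ (//-rightDividesˡ (e n) (δ n)) ⟩
    - (δ n - e n) + δ n                                              ≈⟨ +-comm _ _ ⟩
    δ n - (δ n - e n)                                                ≈⟨ +-congˡ (-‿cong ε*g) ⟨
    δ n - ε * g n                                                    ∎
    where
    open ×-Solver using (_⊕_; _⊜_)
    ε⁻¹ = inv ε ε≉0
    ι = inv (ofℕ (suc n)) (charZero n)
    p = pow (- ε) n
    neg-neg : - ((factorialInv n * ι) * (- ε * p)) ≈ (factorialInv n * ι) * (ε * p)
    neg-neg = trans (-‿cong (*-congˡ (sym (-‿distribˡ-* ε p)))) (trans (-‿cong (sym (-‿distribʳ-* _ _))) (-‿involutive _))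
    ε*g : ε * g n ≈ δ n - e n
    ε*g = trans (sym (*-assoc _ _ _)) (trans (*-congʳ (trans (*-comm _ _) (inv-inverse ε ε≉0))) (*-identityˡ _))

  ∂-g⋆ : ∀ b n → ∂ (g ⋆ b) n ≈ (b n - ε * (g ⋆ b) n) + (g ⋆ ∂ b) n
  ∂-g⋆ b n = trans (∂-⋆ g b n) (+-congʳ (trans (⋆-linearˡ n ε b ∂g) (+-congʳ (δ⋆ b n))))

  ∂-gPow : ∀ k n → ∂ (gPow (suc k)) n ≈ ofℕ (suc k) * (gPow k n - ε * gPow (suc k) n)
  ∂-gPow zero n = begin
    ∂ (g ⋆ δ) n                                ≈⟨ ∂-g⋆ δ n ⟩
    (δ n - ε * gPow 1 n) + (g ⋆ ∂ δ) n         ≈⟨ +-congˡ (sumTo-zero n (λ i → trans (*-congˡ (zeroʳ _)) (zeroʳ _))) ⟩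
    (δ n - ε * gPow 1 n) + 0#                  ≈⟨ +-identityʳ _ ⟩
    δ n - ε * gPow 1 n                         ≈⟨ trans (*-congʳ (+-identityʳ 1#)) (*-identityˡ _) ⟨
    ofℕ 1 * (δ n - ε * gPow 1 n)               ∎
  ∂-gPow (suc k) n = begin
    ∂ (g ⋆ gPow (suc k)) n                     ≈⟨ ∂-g⋆ (gPow (suc k)) n ⟩
    X + (g ⋆ ∂ (gPow (suc k))) n               ≈⟨ +-congˡ (⋆-linearʳ n g (ofℕ (suc k)) ε (∂-gPow k)) ⟩
    X + ofℕ (suc k) * X                        ≈⟨ +-congʳ (*-identityˡ X) ⟨
    1# * X + ofℕ (suc k) * X                   ≈⟨ distribʳ _ _ _ ⟨
    ofℕ (suc (suc k)) * X                      ∎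
    where
    X = gPow (suc k) n - ε * gPow (suc (suc k)) n

  ofℕ[n!]*gPow : ∀ n k → ofℕ (n !) * gPow k n ≈ ofℕ (k !) * stirling₂ε n k
  ofℕ[n!]*gPow zero zero = refl
  ofℕ[n!]*gPow zero (suc k) = trans (*-congˡ (trans (*-congʳ g-zero) (zeroˡ _))) (trans (zeroʳ _) (sym (zeroʳ _)))
  ofℕ[n!]*gPow (suc n) zero = trans (zeroʳ _) (sym (zeroʳ _))
  ofℕ[n!]*gPow (suc n) (suc k) = begin
    ofℕ (suc n ℕ.* n !) * gPow (suc k) (suc n)                      ≈⟨ *-congʳ (ofℕ-* (suc n) (n !)) ⟩
    (ofℕ (suc n) * ofℕ (n !)) * gPow (suc k) (suc n)                ≈⟨ trans (*-congʳ (*-comm _ _)) (*-assoc _ _ _) ⟩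
    ofℕ (n !) * ∂ (gPow (suc k)) n                                  ≈⟨ *-congˡ (∂-gPow k n) ⟩
    ofℕ (n !) * (m * (gPow k n - ε * gPow (suc k) n))               ≈⟨ x*[y*z]≈y*[x*z] _ _ _ ⟩
    m * (ofℕ (n !) * (gPow k n - ε * gPow (suc k) n))               ≈⟨ *-congˡ (x[y-z]≈xy-xz _ _ _) ⟩
    m * (ofℕ (n !) * gPow k n - ofℕ (n !) * (ε * gPow (suc k) n))   ≈⟨ *-congˡ (+-cong (ofℕ[n!]*gPow n k)
                                                                          (-‿cong (trans (x*[y*z]≈y*[x*z] _ _ _) (*-congˡ (ofℕ[n!]*gPow n (suc k)))))) ⟩
    m * (F * c₀ - ε * (ofℕ (suc k !) * c₁))                          ≈⟨ *-congˡ (+-congˡ (-‿cong (*-congˡ (*-congʳ (ofℕ-* (suc k) (k !)))))) ⟩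
    m * (F * c₀ - ε * ((m * F) * c₁))                                ≈⟨ x[y-z]≈xy-xz _ _ _ ⟩
    m * (F * c₀) - m * (ε * ((m * F) * c₁))                          ≈⟨ +-cong (sym (*-assoc _ _ _)) (-‿cong reorder) ⟩
    (m * F) * c₀ - (m * F) * ((m * ε) * c₁)                          ≈⟨ x[y-z]≈xy-xz _ _ _ ⟨
    (m * F) * stirling₂ε (suc n) (suc k)                            ≈⟨ *-congʳ (ofℕ-* (suc k) (k !)) ⟨
    ofℕ (suc k !) * stirling₂ε (suc n) (suc k)                      ∎
    where
    open ×-Solver using (_⊕_; _⊜_)
    m = ofℕ (suc k)
    F = ofℕ (k !)
    c₀ = stirling₂ε n k
    c₁ = stirling₂ε n (suc k)
    reorder : m * (ε * ((m * F) * c₁)) ≈ (m * F) * ((m * ε) * c₁)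
    reorder = ×-Solver.solve 4 (λ m ε F c → (m ⊕ (ε ⊕ ((m ⊕ F) ⊕ c))) ⊜ ((m ⊕ F) ⊕ ((m ⊕ ε) ⊕ c))) refl m ε F c₁

module ExponentialIdentity {c ℓ a ℓa} {K : CharZeroField c ℓ} (𝒜 : AlgebraOver K a ℓa)
                           (A B : AlgebraOver.Carrier 𝒜) (ε lam : CharZeroField.Carrier K)
                           (ε≉0 : ¬ (CharZeroField._≈_ K ε (CharZeroField.0# K)))
                           (lam≉0 : ¬ (CharZeroField._≈_ K lam (CharZeroField.0# K))) where
  open AlgebraOver 𝒜
  open K using () renaming (Carrier to Sc; _*_ to _*ₖ_; _-_ to _-ₖ_; 1# to 1ₖ; _≈_ to _≈ₖ_;
                            ofℕ to ofℕₖ; pow to powₖ; prodBelow to prodₖ; sumTo to sumₖ)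
  open RingLemmas ring
  open ScalarAction 𝒜
  open NormalOrdering 𝒜 A B using (normalOrdered)
  open StirlingExpansions 𝒜 A B ε lam using (S; bracketPow; stirling₂Sum; risingBracket-suc)
  open ScaledStirling K.commutativeRing ε using (stirling₂ε)
  open ExponentialSeries K ε ε≉0 using (factorialInv; g; gPow; ofℕ[n!]*factorialInv; factorialInv-binomial; ofℕ[n!]*gPow)
  open Conditions 𝒜 using (Series; _⋆_; powS; seriesPow; expS; binomGen; oneMinusExpOver; risingBracket; CondIII)
  open SetoidReasoning setoid
  private
    module K′ = RingLemmas K.ring
    module ×-Solver = CommutativeMonoidSolver K.*-commutativeMonoid

  μ : Sc
  μ = K.inv lam lam≉0

  Y : Series
  Y m = (lam *ₖ oneMinusExpOver ε ε≉0 m) · (A + B)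

  oneMinusExpOver≡g : ∀ n → oneMinusExpOver ε ε≉0 n ≡ g n
  oneMinusExpOver≡g zero = P.refl
  oneMinusExpOver≡g (suc n) = P.refl

  powS-Y : ∀ k n → powS Y k n ≈ (powₖ lam k *ₖ gPow k n) · pow S k
  powS-Y zero zero = sym (trans (·-congʳ (K.*-identityˡ _)) (·-identity _))
  powS-Y zero (suc n) = sym (trans (·-congʳ (K.*-identityˡ _)) (·-zeroˡ _))
  powS-Y (suc k) n = begin
    sumTo n (λ i → Y i * powS Y k (n ∸ i))                                          ≈⟨ sumTo-cong n (λ i _ → term i) ⟩
    sumTo n (λ i → (powₖ lam (suc k) *ₖ (g i *ₖ gPow k (n ∸ i))) · pow S (suc k))   ≈⟨ sumTo-· n _ _ ⟨
    sumₖ n (λ i → powₖ lam (suc k) *ₖ (g i *ₖ gPow k (n ∸ i))) · pow S (suc k)      ≈⟨ ·-congʳ (K′.*-distribˡ-sumTo n _ _) ⟨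
    (powₖ lam (suc k) *ₖ gPow (suc k) n) · pow S (suc k)                            ∎
    where
    open ×-Solver using (_⊕_; _⊜_)
    term : ∀ i → Y i * powS Y k (n ∸ i) ≈ (powₖ lam (suc k) *ₖ (g i *ₖ gPow k (n ∸ i))) · pow S (suc k)
    term i = begin
      Y i * powS Y k (n ∸ i)                                                 ≈⟨ *-congˡ (powS-Y k (n ∸ i)) ⟩
      Y i * ((powₖ lam k *ₖ gPow k (n ∸ i)) · pow S k)                        ≈⟨ ·-*-· _ _ _ _ ⟩
      ((lam *ₖ oneMinusExpOver ε ε≉0 i) *ₖ (powₖ lam k *ₖ gPow k (n ∸ i))) · pow S (suc k)
                                                                             ≈⟨ ·-congʳ (K.trans (K.*-congʳ (K.*-congˡ (K′.≡⇒≈ (oneMinusExpOver≡g i)))) reorder) ⟩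
      (powₖ lam (suc k) *ₖ (g i *ₖ gPow k (n ∸ i))) · pow S (suc k)           ∎
      where
      reorder : (lam *ₖ g i) *ₖ (powₖ lam k *ₖ gPow k (n ∸ i)) ≈ₖ powₖ lam (suc k) *ₖ (g i *ₖ gPow k (n ∸ i))
      reorder = ×-Solver.solve 4 (λ l g p h → ((l ⊕ g) ⊕ (p ⊕ h)) ⊜ ((l ⊕ p) ⊕ (g ⊕ h))) K.refl lam (g i) (powₖ lam k) (gPow k (n ∸ i))

  lam^k*fallingμ : ∀ k → powₖ lam k *ₖ prodₖ k (λ i → μ -ₖ ofℕₖ i) ≈ₖ risingBracket lam k
  lam^k*fallingμ zero = K.*-identityˡ 1ₖ
  lam^k*fallingμ (suc k) = K.trans (×-Solver.solve 4 (λ l p q f → ((l ⊕ p) ⊕ (q ⊕ f)) ⊜ ((p ⊕ q) ⊕ (l ⊕ f))) K.refl lam (powₖ lam k) _ _)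
                           (K.trans (K.*-cong (lam^k*fallingμ k) lam[μ-k]) (K.sym (risingBracket-suc k)))
    where
    open ×-Solver using (_⊕_; _⊜_)
    lam[μ-k] : lam *ₖ (μ -ₖ ofℕₖ k) ≈ₖ 1ₖ -ₖ ofℕₖ k *ₖ lam
    lam[μ-k] = K.trans (K′.x[y-z]≈xy-xz _ _ _) (K.+-cong (K.trans (K.*-comm _ _) (K.inv-inverse lam lam≉0)) (K.-‿cong (K.*-comm _ _)))

  binomGen*coefficient : ∀ n k → binomGen μ k *ₖ (powₖ lam k *ₖ gPow k n) ≈ₖ factorialInv n *ₖ (stirling₂ε n k *ₖ risingBracket lam k)
  binomGen*coefficient n k =
    K.trans (K.*-congˡ (K.*-congˡ gPow≈))
    (K.trans (×-Solver.solve 6 (λ fk P l fn F s → ((fk ⊕ P) ⊕ (l ⊕ (fn ⊕ (F ⊕ s)))) ⊜ ((F ⊕ fk) ⊕ (fn ⊕ (s ⊕ (l ⊕ P)))))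
                               K.refl fk P (powₖ lam k) fn F s)
    (K.trans (K.*-cong (ofℕ[n!]*factorialInv k) (K.*-congˡ (K.*-congˡ (lam^k*fallingμ k))))
             (K.*-identityˡ _)))
    where
    open ×-Solver using (_⊕_; _⊜_)
    fk = factorialInv k
    fn = factorialInv n
    P = prodₖ k (λ i → μ -ₖ ofℕₖ i)
    F = ofℕₖ (k !)
    s = stirling₂ε n k
    gPow≈ : gPow k n ≈ₖ fn *ₖ (F *ₖ s)
    gPow≈ = K.trans (K.sym (K.*-identityˡ _)) (K.trans (K.*-congʳ (K.sym (K.trans (K.*-comm _ _) (ofℕ[n!]*factorialInv n))))
              (K.trans (K.*-assoc _ _ _) (K.*-congˡ (ofℕ[n!]*gPow n k))))

  seriesPow-Y : ∀ n → seriesPow Y μ n ≈ factorialInv n · stirling₂Sum n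
  seriesPow-Y n = begin
    sumTo n (λ k → binomGen μ k · powS Y k n)                                         ≈⟨ sumTo-cong n (λ k _ → term k) ⟩
    sumTo n (λ k → factorialInv n · (stirling₂ε n k · bracketPow k))                 ≈⟨ ·-sumTo n _ _ ⟨
    factorialInv n · stirling₂Sum n                                                   ∎
    where
    term : ∀ k → binomGen μ k · powS Y k n ≈ factorialInv n · (stirling₂ε n k · bracketPow k)
    term k = begin
      binomGen μ k · powS Y k n                                                       ≈⟨ ·-congˡ (powS-Y k n) ⟩
      binomGen μ k · ((powₖ lam k *ₖ gPow k n) · pow S k)                             ≈⟨ ·-assoc _ _ _ ⟨
      (binomGen μ k *ₖ (powₖ lam k *ₖ gPow k n)) · pow S k                            ≈⟨ ·-congʳ (binomGen*coefficient n k) ⟩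
      (factorialInv n *ₖ (stirling₂ε n k *ₖ risingBracket lam k)) · pow S k          ≈⟨ trans (·-assoc _ _ _) (·-congˡ (·-assoc _ _ _)) ⟩
      factorialInv n · (stirling₂ε n k · bracketPow k)                               ∎

  exp⋆exp : ∀ n → (expS A ⋆ expS B) n ≈ factorialInv n · normalOrdered n
  exp⋆exp n = begin
    sumTo n (λ i → expS A i * expS B (n ∸ i))                                         ≈⟨ sumTo-cong n term ⟩
    sumTo n (λ i → factorialInv n · (ofℕₖ (n C i) · (pow A i * pow B (n ∸ i))))      ≈⟨ ·-sumTo n _ _ ⟨
    factorialInv n · normalOrdered n                                                  ∎
    where
    term : ∀ i → i ≤ n → expS A i * expS B (n ∸ i) ≈ factorialInv n · (ofℕₖ (n C i) · (pow A i * pow B (n ∸ i)))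
    term i i≤n = trans (·-*-· _ _ _ _) (trans (·-congʳ (factorialInv-binomial i≤n)) (·-assoc _ _ _))

  factorialInv·-cancel : ∀ n {x y} → factorialInv n · x ≈ factorialInv n · y → x ≈ y
  factorialInv·-cancel n {x} {y} eq = begin
    x                                          ≈⟨ trans (·-congʳ (ofℕ[n!]*factorialInv n)) (·-identity x) ⟨
    (ofℕₖ (n !) *ₖ factorialInv n) · x         ≈⟨ trans (·-assoc _ _ _) (·-congˡ eq) ⟩
    ofℕₖ (n !) · (factorialInv n · y)          ≈⟨ trans (sym (·-assoc _ _ _)) (trans (·-congʳ (ofℕ[n!]*factorialInv n)) (·-identity y)) ⟩
    y                                          ∎

  condIII⇔stirling₂Expansion : CondIII A B ε lam ε≉0 lam≉0 ⇔ (∀ n → normalOrdered n ≈ stirling₂Sum n)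
  condIII⇔stirling₂Expansion = mk⇔
    (λ h n → factorialInv·-cancel n (trans (sym (exp⋆exp n)) (trans (h n) (seriesPow-Y n))))
    (λ h n → trans (exp⋆exp n) (trans (·-congˡ (h n)) (sym (seriesPow-Y n))))

theorem4p1 : ∀ {c ℓ a ℓa : Level} {K : CharZeroField c ℓ} (𝒜 : AlgebraOver K a ℓa)
    (A B : AlgebraOver.Carrier 𝒜) (ε lam : CharZeroField.Carrier K)
    (ε≉0 : ¬ (CharZeroField._≈_ K ε (CharZeroField.0# K)))
    (lam≉0 : ¬ (CharZeroField._≈_ K lam (CharZeroField.0# K))) →
    (Conditions.CondI 𝒜 A B ε lam ⇔ Conditions.CondII 𝒜 A B ε lam)
      × (Conditions.CondI 𝒜 A B ε lam ⇔ Conditions.CondIII 𝒜 A B ε lam ε≉0 lam≉0)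
theorem4p1 𝒜 A B ε lam ε≉0 lam≉0 =
    mk⇔ (λ hyp → UnderCommutation.condII hyp) condII⇒condI
  , mk⇔ (λ hyp → from condIII⇔ (UnderCommutation.normalOrdered≈stirling₂Sum hyp))
        (λ h → stirling₂Expansion⇒condI (to condIII⇔ h 2))
  where
  open StirlingExpansions 𝒜 A B ε lam
  open ExponentialIdentity 𝒜 A B ε lam ε≉0 lam≉0 using () renaming (condIII⇔stirling₂Expansion to condIII⇔)
  open Equivalence using (to; from)
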